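{- Let $p\in\mathbf{P}[X_1,\ldots,X_m]$ and $\mathbf{q}\in\mathbf{P}$. If $p(\vec{\mathbf{r}})=\mathbf{q}$ for some $\vec{\mathbf{r}}=(\mathbf{r}_1,\ldots,\mathbf{r}_m)\in\mathbf{P}^m$, then there exists a (possibly different) $\vec{\mathbf{s}}=(\mathbf{s}_1,\ldots,\mathbf{s}_m)\in\mathbf{P}^m$ with $p(\vec{\mathbf{s}})=\mathbf{q}$ and $s_{i,j}\le q_j$ for all $1\le i\le m$ and $j\in\mathbb{N}$, where $\mathbf{s}_i=(s_{i,j})_{j\in\mathbb{N}}$.
   Context: A profile is a sequence $\mathbf{p}=(p_i)_{i\in\mathbb{N}}$ of natural numbers for which there exists $h\ge -1$ with $p_i\ge 1$ for $0\le i\le h$ and $p_i=0$ for $i>h$. $\mathbf{P}$ is the set of profiles, a commutative semiring with elementwise sum, product $(\mathbf{p}\times\mathbf{q})_i = p_i\sum_{j=0}^i q_j + q_i\sum_{j=0}^i p_j - p_i q_i$, zero $(0)$ and one $(1)$. $\mathbf{P}[X_1,\ldots,X_m]$ is the semiring of polynomials with coefficients in $\mathbf{P}$. -}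

module Defs where

open import Data.Nat using (ℕ; zero; suc; _+_; _*_; _∸_; _≤_; _<_)
open import Data.Fin using (Fin)
import Data.Fin as F
open import Data.List using (List; foldr)
open import Data.Product using (Σ; _×_; _,_; proj₁; proj₂)
open import Relation.Binary.PropositionalEquality using (_≡_)

Seq : Set
Seq = ℕ → ℕ

-- A profile: there is h ≥ -1 (encoded as n = h + 1 ∈ ℕ) with
-- p_i ≥ 1 for i < n (i.e. 0 ≤ i ≤ h) and p_i = 0 for i ≥ n (i.e. i > h).
IsProfile : Seq → Set
IsProfile p = Σ ℕ λ n → (∀ i → i < n → 1 ≤ p i) × (∀ i → n ≤ i → p i ≡ 0)

Profile : Set
Profile = Σ Seq IsProfile

psum : Seq → ℕ → ℕ
psum p zero    = p zero
psum p (suc i) = psum p i + p (suc i)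

𝟘 : Seq
𝟘 _ = 0

𝟙 : Seq
𝟙 zero    = 1
𝟙 (suc _) = 0

_⊕_ : Seq → Seq → Seq
(p ⊕ q) i = p i + q i

_⊗_ : Seq → Seq → Seq
(p ⊗ q) i = (p i * psum q i + q i * psum p i) ∸ p i * q i

infixl 6 _⊕_
infixl 7 _⊗_

_^ˢ_ : Seq → ℕ → Seq
p ^ˢ zero  = 𝟙
p ^ˢ suc k = p ⊗ (p ^ˢ k)

prodFin : (m : ℕ) → (Fin m → Seq) → Seq
prodFin zero    f = 𝟙
prodFin (suc m) f = f F.zero ⊗ prodFin m (λ i → f (F.suc i))

-- A polynomial in P[X_1,…,X_m]: a finite formal sum of terms  c · X^e,
-- with coefficient c ∈ P and exponent vector e : Fin m → ℕ.
Poly : ℕ → Set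
Poly m = List (Profile × (Fin m → ℕ))

evalTerm : {m : ℕ} → (Fin m → Profile) → Profile × (Fin m → ℕ) → Seq
evalTerm {m} r (c , e) = proj₁ c ⊗ prodFin m (λ i → proj₁ (r i) ^ˢ e i)

eval : {m : ℕ} → Poly m → (Fin m → Profile) → Seq
eval p r = foldr (λ t acc → evalTerm r t ⊕ acc) 𝟘 p

-- Clip every r_i to q pointwise, s_i := r_i ⊓ q, which is again a profile. A term c·X^e
-- whose value has head 0 vanishes identically at r and at s, because a product of
-- profiles with zero head is 0. Otherwise every factor has positive head, so each
-- variable occurring in the term is dominated pointwise by the term, hence by
-- p(r) = q; the clip leaves such variables unchanged and the term keeps its value.
module Submission where

open import Defs
open import Data.Nat using (ℕ; zero; suc; _+_; _*_; _∸_; _≤_; _⊓_; z≤n; s≤s)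
open import Data.Nat.Properties
open import Data.Fin using (Fin)
import Data.Fin as F
open import Data.List using ([]; _∷_)
open import Data.Product using (Σ; _×_; _,_; proj₁; proj₂)
open import Data.Sum using (inj₁; inj₂)
open import Data.Empty using (⊥-elim)
open import Function using (_∘_)
open import Relation.Binary.PropositionalEquality

infix 4 _≐_ _≤ˢ_

_≐_ : Seq → Seq → Set
a ≐ b = ∀ j → a j ≡ b j

_≤ˢ_ : Seq → Seq → Set
a ≤ˢ b = ∀ j → a j ≤ b j

≤ˢ-trans : ∀ {a b c} → a ≤ˢ b → b ≤ˢ c → a ≤ˢ c
≤ˢ-trans a≤b b≤c j = ≤-trans (a≤b j) (b≤c j)

⊗-head : ∀ a b → (a ⊗ b) 0 ≡ a 0 * b 0
⊗-head a b = begin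
    (a 0 * b 0 + b 0 * a 0) ∸ a 0 * b 0 ≡⟨ cong (λ x → (a 0 * b 0 + x) ∸ a 0 * b 0) (*-comm (b 0) (a 0)) ⟩
    (a 0 * b 0 + a 0 * b 0) ∸ a 0 * b 0 ≡⟨ m+n∸n≡m (a 0 * b 0) (a 0 * b 0) ⟩
    a 0 * b 0                           ∎
  where open ≡-Reasoning

⊗-comm : ∀ a b → a ⊗ b ≐ b ⊗ a
⊗-comm a b j = cong₂ _∸_ (+-comm (a j * psum b j) (b j * psum a j)) (*-comm (a j) (b j))

psum-cong : ∀ {a b} → a ≐ b → psum a ≐ psum b
psum-cong a≐b zero    = a≐b zero
psum-cong a≐b (suc i) = cong₂ _+_ (psum-cong a≐b i) (a≐b (suc i))

⊗-cong : ∀ {a a′ b b′} → a ≐ a′ → b ≐ b′ → a ⊗ b ≐ a′ ⊗ b′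
⊗-cong a≐a′ b≐b′ j rewrite a≐a′ j | b≐b′ j | psum-cong a≐a′ j | psum-cong b≐b′ j = refl

^ˢ-cong : ∀ {a b} k → a ≐ b → a ^ˢ k ≐ b ^ˢ k
^ˢ-cong zero    a≐b j = refl
^ˢ-cong (suc k) a≐b   = ⊗-cong a≐b (^ˢ-cong k a≐b)

prodFin-cong : ∀ m {f g : Fin m → Seq} → (∀ i → f i ≐ g i) → prodFin m f ≐ prodFin m g
prodFin-cong zero    f≐g j = refl
prodFin-cong (suc m) f≐g   = ⊗-cong (f≐g F.zero) (prodFin-cong m (f≐g ∘ F.suc))

psum-𝟘 : ∀ {a} → a ≐ 𝟘 → psum a ≐ 𝟘
psum-𝟘 a≐𝟘 zero                                       = a≐𝟘 zero
psum-𝟘 a≐𝟘 (suc i) rewrite psum-𝟘 a≐𝟘 i | a≐𝟘 (suc i) = refl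

⊗-zeroˡ : ∀ {a} b → a ≐ 𝟘 → a ⊗ b ≐ 𝟘
⊗-zeroˡ b a≐𝟘 j rewrite a≐𝟘 j | psum-𝟘 a≐𝟘 j | *-zeroʳ (b j) = refl

⊗-zeroʳ : ∀ a {b} → b ≐ 𝟘 → a ⊗ b ≐ 𝟘
⊗-zeroʳ a {b} b≐𝟘 j = trans (⊗-comm a b j) (⊗-zeroˡ a b≐𝟘 j)

head≤psum : ∀ a j → a 0 ≤ psum a j
head≤psum a zero    = ≤-refl
head≤psum a (suc j) = ≤-trans (head≤psum a j) (m≤m+n _ _)

a≤psum : ∀ a j → a j ≤ psum a j
a≤psum a zero    = ≤-refl
a≤psum a (suc j) = m≤n+m _ _

a≤a⊗b : ∀ a b → 1 ≤ b 0 → a ≤ˢ a ⊗ b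
a≤a⊗b a b 1≤b₀ j = begin
    a j                                        ≡⟨ sym (m+n∸n≡m (a j) (a j * b j)) ⟩
    (a j + a j * b j) ∸ a j * b j              ≤⟨ ∸-monoˡ-≤ (a j * b j) (+-mono-≤ a≤aΣb b≤bΣa) ⟩
    (a j * psum b j + b j * psum a j) ∸ a j * b j ∎
  where
    open ≤-Reasoning
    a≤aΣb : a j ≤ a j * psum b j
    a≤aΣb = subst (_≤ a j * psum b j) (*-identityʳ (a j))
                  (*-monoʳ-≤ (a j) (≤-trans 1≤b₀ (head≤psum b j)))
    b≤bΣa : a j * b j ≤ b j * psum a j
    b≤bΣa = subst (_≤ b j * psum a j) (*-comm (b j) (a j)) (*-monoʳ-≤ (b j) (a≤psum a j))

b≤a⊗b : ∀ a b → 1 ≤ a 0 → b ≤ˢ a ⊗ b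
b≤a⊗b a b 1≤a₀ j = subst (b j ≤_) (⊗-comm b a j) (a≤a⊗b b a 1≤a₀ j)

*-positive⁻¹ : ∀ x y → 1 ≤ x * y → 1 ≤ x × 1 ≤ y
*-positive⁻¹ (suc x) zero    1≤xy rewrite *-zeroʳ x = ⊥-elim (<-irrefl refl 1≤xy)
*-positive⁻¹ (suc x) (suc y) _                      = s≤s z≤n , s≤s z≤n

⊗-head-positive⁻¹ : ∀ a b → 1 ≤ (a ⊗ b) 0 → 1 ≤ a 0 × 1 ≤ b 0
⊗-head-positive⁻¹ a b pos = *-positive⁻¹ (a 0) (b 0) (subst (1 ≤_) (⊗-head a b) pos)

^ˢ-dominates : ∀ a k → 1 ≤ (a ^ˢ suc k) 0 → a ≤ˢ a ^ˢ suc k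
^ˢ-dominates a k pos = a≤a⊗b a (a ^ˢ k) (proj₂ (⊗-head-positive⁻¹ a (a ^ˢ k) pos))

prodFin-dominates : ∀ m f → 1 ≤ prodFin m f 0 → ∀ i → 1 ≤ f i 0 × f i ≤ˢ prodFin m f
prodFin-dominates (suc m) f pos i with ⊗-head-positive⁻¹ (f F.zero) (prodFin m (f ∘ F.suc)) pos | i
... | 1≤f₀ , 1≤rest | F.zero  = 1≤f₀ , a≤a⊗b (f F.zero) (prodFin m (f ∘ F.suc)) 1≤rest
... | 1≤f₀ , 1≤rest | F.suc i =
  let 1≤fᵢ , fᵢ≤rest = prodFin-dominates m (f ∘ F.suc) 1≤rest i
  in  1≤fᵢ , ≤ˢ-trans fᵢ≤rest (b≤a⊗b (f F.zero) (prodFin m (f ∘ F.suc)) 1≤f₀)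

⊗-head-mono : ∀ a a′ b b′ → a 0 ≤ a′ 0 → b 0 ≤ b′ 0 → (a ⊗ b) 0 ≤ (a′ ⊗ b′) 0
⊗-head-mono a a′ b b′ a≤a′ b≤b′ rewrite ⊗-head a b | ⊗-head a′ b′ = *-mono-≤ a≤a′ b≤b′

^ˢ-head-mono : ∀ a b k → a 0 ≤ b 0 → (a ^ˢ k) 0 ≤ (b ^ˢ k) 0
^ˢ-head-mono a b zero    a≤b = ≤-refl
^ˢ-head-mono a b (suc k) a≤b = ⊗-head-mono a b (a ^ˢ k) (b ^ˢ k) a≤b (^ˢ-head-mono a b k a≤b)

prodFin-head-mono : ∀ m f g → (∀ i → f i 0 ≤ g i 0) → prodFin m f 0 ≤ prodFin m g 0
prodFin-head-mono zero    f g f≤g = ≤-refl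
prodFin-head-mono (suc m) f g f≤g =
  ⊗-head-mono (f F.zero) (g F.zero) (prodFin m (f ∘ F.suc)) (prodFin m (g ∘ F.suc))
              (f≤g F.zero)
              (prodFin-head-mono m (f ∘ F.suc) (g ∘ F.suc) (f≤g ∘ F.suc))

ZeroIfHeadZero : Seq → Set
ZeroIfHeadZero a = a 0 ≡ 0 → a ≐ 𝟘

profile-zeroIfHeadZero : (c : Profile) → ZeroIfHeadZero (proj₁ c)
profile-zeroIfHeadZero (a , zero  , _   , zeros) _   j = zeros j z≤n
profile-zeroIfHeadZero (a , suc n , pos , _)     a₀≡0 = ⊥-elim (<-irrefl (sym a₀≡0) (pos 0 (s≤s z≤n)))

𝟙-zeroIfHeadZero : ZeroIfHeadZero 𝟙
𝟙-zeroIfHeadZero ()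

⊗-zeroIfHeadZero : ∀ {a b} → ZeroIfHeadZero a → ZeroIfHeadZero b → ZeroIfHeadZero (a ⊗ b)
⊗-zeroIfHeadZero {a} {b} za zb head≡0 with m*n≡0⇒m≡0∨n≡0 (a 0) (trans (sym (⊗-head a b)) head≡0)
... | inj₁ a₀≡0 = ⊗-zeroˡ b (za a₀≡0)
... | inj₂ b₀≡0 = ⊗-zeroʳ a (zb b₀≡0)

^ˢ-zeroIfHeadZero : ∀ {a} k → ZeroIfHeadZero a → ZeroIfHeadZero (a ^ˢ k)
^ˢ-zeroIfHeadZero zero    za = 𝟙-zeroIfHeadZero
^ˢ-zeroIfHeadZero (suc k) za = ⊗-zeroIfHeadZero za (^ˢ-zeroIfHeadZero k za)

prodFin-zeroIfHeadZero : ∀ m {f} → (∀ i → ZeroIfHeadZero (f i)) → ZeroIfHeadZero (prodFin m f)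
prodFin-zeroIfHeadZero zero    zf = 𝟙-zeroIfHeadZero
prodFin-zeroIfHeadZero (suc m) zf =
  ⊗-zeroIfHeadZero (zf F.zero) (prodFin-zeroIfHeadZero m (zf ∘ F.suc))

evalTerm-zeroIfHeadZero : ∀ {m} (r : Fin m → Profile) t → ZeroIfHeadZero (evalTerm r t)
evalTerm-zeroIfHeadZero {m} r (c , e) =
  ⊗-zeroIfHeadZero (profile-zeroIfHeadZero c)
    (prodFin-zeroIfHeadZero m (λ i → ^ˢ-zeroIfHeadZero (e i) (profile-zeroIfHeadZero (r i))))

evalTerm-head-mono : ∀ {m} (s r : Fin m → Profile) t →
  (∀ i → proj₁ (s i) 0 ≤ proj₁ (r i) 0) → evalTerm s t 0 ≤ evalTerm r t 0
evalTerm-head-mono {m} s r (c , e) s≤r =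
  ⊗-head-mono (proj₁ c) (proj₁ c) (prodFin m sᵉ) (prodFin m rᵉ) ≤-refl
    (prodFin-head-mono m sᵉ rᵉ (λ i → ^ˢ-head-mono (proj₁ (s i)) (proj₁ (r i)) (e i) (s≤r i)))
  where
    sᵉ = λ i → proj₁ (s i) ^ˢ e i
    rᵉ = λ i → proj₁ (r i) ^ˢ e i

evalTerm-dominates-variable : ∀ {m} (r : Fin m → Profile) c e → 1 ≤ evalTerm r (c , e) 0 →
  ∀ i k → e i ≡ suc k → proj₁ (r i) ≤ˢ evalTerm r (c , e)
evalTerm-dominates-variable {m} r c e pos i k eᵢ≡1+k =
  ≤ˢ-trans rᵢ≤rᵢ^eᵢ (≤ˢ-trans (proj₂ (prodFin-dominates m powers 1≤P₀ i)) (b≤a⊗b (proj₁ c) P 1≤c₀))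
  where
    powers = λ i → proj₁ (r i) ^ˢ e i
    P      = prodFin m powers
    1≤c₀ = proj₁ (⊗-head-positive⁻¹ (proj₁ c) P pos)
    1≤P₀ = proj₂ (⊗-head-positive⁻¹ (proj₁ c) P pos)
    rᵢ≤rᵢ^eᵢ : proj₁ (r i) ≤ˢ powers i
    rᵢ≤rᵢ^eᵢ rewrite eᵢ≡1+k =
      ^ˢ-dominates (proj₁ (r i)) k (subst (λ n → 1 ≤ (proj₁ (r i) ^ˢ n) 0) eᵢ≡1+k
                                          (proj₁ (prodFin-dominates m powers 1≤P₀ i)))

⊓-isProfile : ∀ {a b} → IsProfile a → IsProfile b → IsProfile (λ j → a j ⊓ b j)
⊓-isProfile {a} {b} (n , a-pos , a-zero) (n′ , b-pos , b-zero) = n ⊓ n′ , pos , zeros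
  where
    pos : ∀ i → suc i ≤ n ⊓ n′ → 1 ≤ a i ⊓ b i
    pos i i<n⊓n′ = ⊓-glb (a-pos i (≤-trans i<n⊓n′ (m⊓n≤m n n′))) (b-pos i (≤-trans i<n⊓n′ (m⊓n≤n n n′)))
    zeros : ∀ i → n ⊓ n′ ≤ i → a i ⊓ b i ≡ 0
    zeros i n⊓n′≤i with ⊓-sel n n′
    ... | inj₁ ≡n  rewrite a-zero i (subst (_≤ i) ≡n n⊓n′≤i)  = refl
    ... | inj₂ ≡n′ rewrite b-zero i (subst (_≤ i) ≡n′ n⊓n′≤i) = m≥n⇒m⊓n≡n z≤n

_⊓ᴾ_ : Profile → Profile → Profile
a ⊓ᴾ b = (λ j → proj₁ a j ⊓ proj₁ b j) , ⊓-isProfile (proj₂ a) (proj₂ b)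

clip : ∀ {m} → (Fin m → Profile) → Profile → Fin m → Profile
clip r q i = r i ⊓ᴾ q

evalTerm-clip : ∀ {m} (r : Fin m → Profile) q t →
  evalTerm r t ≤ˢ proj₁ q → evalTerm (clip r q) t ≐ evalTerm r t
evalTerm-clip {m} r q (c , e) T≤q with evalTerm r (c , e) 0 in T₀≡
... | zero = λ j → trans (evalTerm-zeroIfHeadZero (clip r q) (c , e) clipped-T₀≡0 j)
                         (sym (evalTerm-zeroIfHeadZero r (c , e) T₀≡ j))
  where
    clipped-T₀≡0 : evalTerm (clip r q) (c , e) 0 ≡ 0
    clipped-T₀≡0 = n≤0⇒n≡0 (subst (evalTerm (clip r q) (c , e) 0 ≤_) T₀≡
                                  (evalTerm-head-mono (clip r q) r (c , e) (λ i → m⊓n≤m _ _)))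
... | suc _ = ⊗-cong {proj₁ c} (λ _ → refl) (prodFin-cong m factor)
  where
    factor : ∀ i → proj₁ (clip r q i) ^ˢ e i ≐ proj₁ (r i) ^ˢ e i
    factor i with e i in eᵢ≡
    ... | zero  = λ _ → refl
    ... | suc k = ^ˢ-cong (suc k) (λ j → m≤n⇒m⊓n≡m (rᵢ≤q j))
      where
        rᵢ≤q : proj₁ (r i) ≤ˢ proj₁ q
        rᵢ≤q = ≤ˢ-trans (evalTerm-dominates-variable r c e (subst (1 ≤_) (sym T₀≡) (s≤s z≤n)) i k eᵢ≡) T≤q

eval-clip : ∀ {m} (p : Poly m) (r : Fin m → Profile) q →
  eval p r ≤ˢ proj₁ q → eval p (clip r q) ≐ eval p r
eval-clip []      r q _     j = refl
eval-clip (t ∷ p) r q p≤q j =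
  cong₂ _+_ (evalTerm-clip r q t (λ j → ≤-trans (m≤m+n _ _) (p≤q j)) j)
            (eval-clip p r q (λ j → ≤-trans (m≤n+m _ _) (p≤q j)) j)

lemma10 : (m : ℕ) (p : Poly m) (q : Profile) →
    (Σ (Fin m → Profile) λ r → ∀ j → eval p r j ≡ proj₁ q j) →
    Σ (Fin m → Profile) λ s →
      (∀ j → eval p s j ≡ proj₁ q j) × (∀ (i : Fin m) (j : ℕ) → proj₁ (s i) j ≤ proj₁ q j)
lemma10 m p q (r , p[r]≡q) =
  clip r q , (λ j → trans (eval-clip p r q p[r]≤q j) (p[r]≡q j)) , (λ i j → m⊓n≤n _ _)
  where
    p[r]≤q : eval p r ≤ˢ proj₁ q
    p[r]≤q j = ≤-reflexive (p[r]≡q j)
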